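{- Let $n_i$ be an odd positive integer. Let $k_i\geq1$ be the number such that $n_i, C(n_i),\dots,C^{k_i-1}(n_i)$ are all odd and $C^{k_i}(n_i)$ is even, and let $\ell_i\geq1$ be the number such that $C^{k_i}(n_i),\dots,C^{k_i+\ell_i-1}(n_i)$ are all even and $C^{k_i+\ell_i}(n_i)$ is odd. If $\ell_i\geq 2$, then, with $n_i' := \frac{n_i-1}{2}$, we have $C^{k_i+2}(n_i)=C^{k_i+1}(n_i')$; in particular the Collatz sequences of $n_i$ and $n_i'$ merge.
   Context: $C:\mathbb{Z}_{>0}\to\mathbb{Z}_{>0}$ is the Collatz map $C(n)=n/2$ for even $n$ and $C(n)=(3n+1)/2$ for odd $n$; $C^t$ denotes the $t$-fold iterate. -}

module Defs where

open import Data.Nat using (ℕ; zero; suc; _+_; _*_; _/_; _%_)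
open import Relation.Binary.PropositionalEquality using (_≡_)

Even : ℕ → Set
Even n = n % 2 ≡ 0

Odd : ℕ → Set
Odd n = n % 2 ≡ 1

-- The Collatz map C(n) = n/2 (n even), (3n+1)/2 (n odd).
-- (Defined on all of ℕ; C 0 = 0 is irrelevant since only positive inputs occur.)
C : ℕ → ℕ
C n with n % 2
... | 0 = n / 2
... | _ = (3 * n + 1) / 2

iter : ℕ → ℕ → ℕ
iter zero    n = n
iter (suc t) n = iter t (C n)

{-# OPTIONS --safe #-}
module Submission where

-- Write n = 2m + 1 and n′ = m. While the trajectory of n stays odd, n ≡ 3 (mod 4) at every
-- step, and for such n one checks C(n′) = (C n)′; so the trajectory of n′ is the trajectory
-- of n with ′ applied, up to the last odd value y. Two even steps after y force y ≡ 5 (mod 8),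
-- and for y = 8f + 5 both C³ y and C² y′ equal 3f + 2.

open import Defs
open import Data.Nat using (ℕ; zero; suc; _+_; _*_; _∸_; _/_; _<_; _≤_; s≤s; z≤n)
open import Data.Nat.Properties using (≤-refl; +-comm; +-suc)
open import Data.Nat.DivMod using ([m+kn]%n≡m%n; m*n%n≡0; m*n/n≡m)
open import Data.Nat.Tactic.RingSolver using (solve-∀; solve)
open import Data.List using ([]; _∷_)
open import Data.Product using (_×_; ∃; ∃-syntax; _,_)
open import Data.Empty using (⊥-elim)
open import Function using (_∘′_)
open import Relation.Nullary using (¬_)
open import Relation.Binary.PropositionalEquality
  using (_≡_; refl; sym; trans; cong; subst; module ≡-Reasoning)

open ≡-Reasoning

half-pred : ℕ → ℕ
half-pred n = (n ∸ 1) / 2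

data EvenOrOdd : ℕ → Set where
  even : ∀ m → EvenOrOdd (m * 2)
  odd  : ∀ m → EvenOrOdd (1 + m * 2)

evenOrOdd : ∀ n → EvenOrOdd n
evenOrOdd zero = even 0
evenOrOdd (suc n) with evenOrOdd n
... | even m = odd m
... | odd m  = even (suc m)

even-double : ∀ m → Even (m * 2)
even-double m = m*n%n≡0 m 2

odd-suc-double : ∀ m → Odd (1 + m * 2)
odd-suc-double m = [m+kn]%n≡m%n 1 m 2

¬odd-double : ∀ m → ¬ Odd (m * 2)
¬odd-double m o with trans (sym o) (even-double m)
... | ()

¬even-suc-double : ∀ m → ¬ Even (1 + m * 2)
¬even-suc-double m e with trans (sym e) (odd-suc-double m)
... | ()

C-double : ∀ m → C (m * 2) ≡ m
C-double m rewrite even-double m = m*n/n≡m m 2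

C-suc-double : ∀ m → C (1 + m * 2) ≡ 2 + m * 3
C-suc-double m rewrite odd-suc-double m = begin
  (3 * (1 + m * 2) + 1) / 2 ≡⟨ cong (_/ 2) (3[1+2m]+1≡2[2+3m] m) ⟩
  (2 + m * 3) * 2 / 2       ≡⟨ m*n/n≡m (2 + m * 3) 2 ⟩
  2 + m * 3                 ∎
  where
  3[1+2m]+1≡2[2+3m] : ∀ m → 3 * (1 + m * 2) + 1 ≡ (2 + m * 3) * 2
  3[1+2m]+1≡2[2+3m] = solve-∀

half-pred-suc-double : ∀ m → half-pred (1 + m * 2) ≡ m
half-pred-suc-double m = m*n/n≡m m 2

iter-+ : ∀ s t n → iter (s + t) n ≡ iter t (iter s n)
iter-+ zero    t n = refl
iter-+ (suc s) t n = iter-+ s t (C n)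

iter-suc : ∀ t n → iter (suc t) n ≡ C (iter t n)
iter-suc t n = trans (cong (λ s → iter s n) (+-comm 1 t)) (iter-+ t 1 n)

odd∧C-odd⇒≡3-mod-4 : ∀ x → Odd x → Odd (C x) → ∃[ p ] x ≡ 3 + p * 4
odd∧C-odd⇒≡3-mod-4 x ox oCx with evenOrOdd x
... | even m = ⊥-elim (¬odd-double m ox)
... | odd m with evenOrOdd m
...   | even p = ⊥-elim (¬odd-double (1 + p * 3) (subst Odd C[4p+1]≡2[3p+1] oCx))
  where
  C[4p+1]≡2[3p+1] : C (1 + p * 2 * 2) ≡ (1 + p * 3) * 2
  C[4p+1]≡2[3p+1] = trans (C-suc-double (p * 2)) (solve (p ∷ []))
...   | odd p = p , solve (p ∷ [])

odd∧C-even∧C²-even⇒≡5-mod-8 : ∀ y → Odd y → Even (C y) → Even (C (C y)) → ∃[ f ] y ≡ 5 + f * 8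
odd∧C-even∧C²-even⇒≡5-mod-8 y oy eCy eC²y with evenOrOdd y
... | even m = ⊥-elim (¬odd-double m oy)
... | odd m with evenOrOdd m
...   | odd p = ⊥-elim (¬even-suc-double (2 + p * 3) (subst Even C[4p+3]≡1+2[3p+2] eCy))
  where
  C[4p+3]≡1+2[3p+2] : C (1 + (1 + p * 2) * 2) ≡ 1 + (2 + p * 3) * 2
  C[4p+3]≡1+2[3p+2] = trans (C-suc-double (1 + p * 2)) (solve (p ∷ []))
...   | even q with evenOrOdd q
...     | even f = ⊥-elim (¬even-suc-double (f * 3) (subst Even C²[8f+1]≡1+2[3f] eC²y))
  where
  C²[8f+1]≡1+2[3f] : C (C (1 + f * 2 * 2 * 2)) ≡ 1 + f * 3 * 2
  C²[8f+1]≡1+2[3f] = begin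
    C (C (1 + f * 2 * 2 * 2)) ≡⟨ cong C (C-suc-double (f * 2 * 2)) ⟩
    C (2 + f * 2 * 2 * 3)     ≡⟨ cong C (2+12f≡2[1+6f] f) ⟩
    C ((1 + f * 3 * 2) * 2)   ≡⟨ C-double (1 + f * 3 * 2) ⟩
    1 + f * 3 * 2             ∎
    where
    2+12f≡2[1+6f] : ∀ f → 2 + f * 2 * 2 * 3 ≡ (1 + f * 3 * 2) * 2
    2+12f≡2[1+6f] = solve-∀
...     | odd f = f , solve (f ∷ [])

C∘half-pred≡half-pred∘C-on-3-mod-4 : ∀ p → C (half-pred (3 + p * 4)) ≡ half-pred (C (3 + p * 4))
C∘half-pred≡half-pred∘C-on-3-mod-4 p = begin
  C (half-pred (3 + p * 4))             ≡⟨ cong (C ∘′ half-pred) (4p+3≡1+2[1+2p] p) ⟩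
  C (half-pred (1 + (1 + p * 2) * 2))   ≡⟨ cong C (half-pred-suc-double (1 + p * 2)) ⟩
  C (1 + p * 2)                         ≡⟨ C-suc-double p ⟩
  2 + p * 3                             ≡⟨ half-pred-suc-double (2 + p * 3) ⟨
  half-pred (1 + (2 + p * 3) * 2)       ≡⟨ cong half-pred (1+2[2+3p]≡2+3[1+2p] p) ⟩
  half-pred (2 + (1 + p * 2) * 3)       ≡⟨ cong half-pred (C-suc-double (1 + p * 2)) ⟨
  half-pred (C (1 + (1 + p * 2) * 2))   ≡⟨ cong (half-pred ∘′ C) (4p+3≡1+2[1+2p] p) ⟨
  half-pred (C (3 + p * 4))             ∎
  where
  4p+3≡1+2[1+2p] : ∀ p → 3 + p * 4 ≡ 1 + (1 + p * 2) * 2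
  4p+3≡1+2[1+2p] = solve-∀
  1+2[2+3p]≡2+3[1+2p] : ∀ p → 1 + (2 + p * 3) * 2 ≡ 2 + (1 + p * 2) * 3
  1+2[2+3p]≡2+3[1+2p] = solve-∀

C³≡C²∘half-pred-on-5-mod-8 : ∀ f → iter 3 (5 + f * 8) ≡ iter 2 (half-pred (5 + f * 8))
C³≡C²∘half-pred-on-5-mod-8 f = begin
  iter 3 (5 + f * 8)                   ≡⟨ cong (iter 3) (8f+5≡1+2[2+4f] f) ⟩
  C (C (C (1 + (2 + f * 4) * 2)))      ≡⟨ cong (C ∘′ C) (C-suc-double (2 + f * 4)) ⟩
  C (C (2 + (2 + f * 4) * 3))          ≡⟨ cong (C ∘′ C) (8+12f≡2[2[2+3f]] f) ⟩
  C (C ((2 + f * 3) * 2 * 2))          ≡⟨ cong C (C-double ((2 + f * 3) * 2)) ⟩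
  C ((2 + f * 3) * 2)                  ≡⟨ C-double (2 + f * 3) ⟩
  2 + f * 3                            ≡⟨ C-suc-double f ⟨
  C (1 + f * 2)                        ≡⟨ cong C (C-double (1 + f * 2)) ⟨
  C (C ((1 + f * 2) * 2))              ≡⟨ cong (C ∘′ C) (2+4f≡2[1+2f] f) ⟨
  C (C (2 + f * 4))                    ≡⟨ cong (C ∘′ C) (half-pred-suc-double (2 + f * 4)) ⟨
  iter 2 (half-pred (1 + (2 + f * 4) * 2)) ≡⟨ cong (iter 2 ∘′ half-pred) (8f+5≡1+2[2+4f] f) ⟨
  iter 2 (half-pred (5 + f * 8))       ∎
  where
  8f+5≡1+2[2+4f] : ∀ f → 5 + f * 8 ≡ 1 + (2 + f * 4) * 2
  8f+5≡1+2[2+4f] = solve-∀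
  8+12f≡2[2[2+3f]] : ∀ f → 2 + (2 + f * 4) * 3 ≡ (2 + f * 3) * 2 * 2
  8+12f≡2[2[2+3f]] = solve-∀
  2+4f≡2[1+2f] : ∀ f → 2 + f * 4 ≡ (1 + f * 2) * 2
  2+4f≡2[1+2f] = solve-∀

C∘half-pred≡half-pred∘C : ∀ x → Odd x → Odd (C x) → C (half-pred x) ≡ half-pred (C x)
C∘half-pred≡half-pred∘C x ox oCx with odd∧C-odd⇒≡3-mod-4 x ox oCx
... | p , refl = C∘half-pred≡half-pred∘C-on-3-mod-4 p

C³≡C²∘half-pred : ∀ y → Odd y → Even (C y) → Even (C (C y)) → iter 3 y ≡ iter 2 (half-pred y)
C³≡C²∘half-pred y oy eCy eC²y with odd∧C-even∧C²-even⇒≡5-mod-8 y oy eCy eC²y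
... | f , refl = C³≡C²∘half-pred-on-5-mod-8 f

iter∘half-pred≡half-pred∘iter : ∀ j x → (∀ i → i ≤ j → Odd (iter i x)) →
  iter j (half-pred x) ≡ half-pred (iter j x)
iter∘half-pred≡half-pred∘iter zero    x odd≤j = refl
iter∘half-pred≡half-pred∘iter (suc j) x odd≤j = begin
  iter j (C (half-pred x))   ≡⟨ cong (iter j) (C∘half-pred≡half-pred∘C x (odd≤j 0 z≤n) (odd≤j 1 (s≤s z≤n))) ⟩
  iter j (half-pred (C x))   ≡⟨ iter∘half-pred≡half-pred∘iter j (C x) (λ i i≤j → odd≤j (suc i) (s≤s i≤j)) ⟩
  half-pred (iter j (C x))   ∎

lemma9 : (n k ℓ : ℕ) → Odd n →
    1 ≤ k → (∀ j → j < k → Odd (iter j n)) → Even (iter k n) →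
    1 ≤ ℓ → (∀ j → j < ℓ → Even (iter (k + j) n)) → Odd (iter (k + ℓ) n) →
    2 ≤ ℓ →
    (iter (k + 2) n ≡ iter (k + 1) ((n ∸ 1) / 2))
      × (∃ λ s → ∃ λ t → iter s n ≡ iter t ((n ∸ 1) / 2))
lemma9 n (suc k) ℓ _ _ odd<k+1 even-k+1 _ even-k+1+ _ 2≤ℓ = merge , (suc k + 2 , suc k + 1 , merge)
  where
  y : ℕ
  y = iter k n
  iter-[1+k+t]≡iter-[1+t]-y : ∀ t → iter (suc k + t) n ≡ iter (suc t) y
  iter-[1+k+t]≡iter-[1+t]-y t = trans (cong (λ s → iter s n) (sym (+-suc k t))) (iter-+ k (suc t) n)
  merge : iter (suc k + 2) n ≡ iter (suc k + 1) (half-pred n)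
  merge = begin
    iter (suc k + 2) n              ≡⟨ iter-[1+k+t]≡iter-[1+t]-y 2 ⟩
    iter 3 y                        ≡⟨ C³≡C²∘half-pred y (odd<k+1 k (s≤s ≤-refl))
                                         (subst Even (iter-suc k n) even-k+1)
                                         (subst Even (iter-[1+k+t]≡iter-[1+t]-y 1) (even-k+1+ 1 2≤ℓ)) ⟩
    iter 2 (half-pred y)            ≡⟨ cong (iter 2) (iter∘half-pred≡half-pred∘iter k n (λ i i≤k → odd<k+1 i (s≤s i≤k))) ⟨
    iter 2 (iter k (half-pred n))   ≡⟨ iter-+ k 2 (half-pred n) ⟨
    iter (k + 2) (half-pred n)      ≡⟨ cong (λ t → iter t (half-pred n)) (+-suc k 1) ⟩
    iter (suc k + 1) (half-pred n)  ∎
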